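{- Let $n\geq 5$ and let $\pi$ be a cyclic permutation of $[n]$ with standard cycle form $(1,c_2,\dots,c_n)$ such that $\pi\in\mathcal{A}_n(4321;213)$ and $c_2\neq 2$. If $c_r=2$, then the elements after $2$ in the standard cycle form appear in increasing order: $c_{r+1}<c_{r+2}<\cdots<c_n$.
   Context: A permutation $\pi$ of $[n]=\{1,\dots,n\}$ is cyclic if it consists of a single $n$-cycle. Its one-line notation is $\pi_1\pi_2\cdots\pi_n$ with $\pi_i=\pi(i)$. Its standard cycle form is $(c_1,c_2,\dots,c_n)$ with $c_1=1$ and $c_{i+1}=\pi(c_i)$ for $1\le i<n$. A sequence $w_1\cdots w_n$ of distinct integers contains a pattern $\sigma=\sigma_1\cdots\sigma_k\in S_k$ if there are indices $i_1<\dots<i_k$ with $w_{i_s}>w_{i_t}$ iff $\sigma_s>\sigma_t$ for all $s<t$; otherwise it avoids $\sigma$. $\mathcal{A}_n(\sigma;\rho)$ is the set of cyclic permutations of $[n]$ whose one-line notation avoids $\sigma$ and whose standard cycle form $c_1\cdots c_n$, read as a sequence, avoids $\rho$. -}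

module Defs where

open import Data.Nat using (ℕ; zero; suc; _<_)
open import Data.Fin using (Fin; toℕ) renaming (zero to fzero; _<_ to _<ᶠ_)
open import Data.Fin.Permutation using (Permutation′; _⟨$⟩ʳ_)
open import Data.Vec using (Vec; lookup)
open import Data.Product using (Σ; _×_)
open import Function.Bundles using (_⇔_)
open import Relation.Nullary using (¬_)
open import Relation.Binary.PropositionalEquality using (_≡_)

-- Elements of [n] are modelled by Fin n; the element i : Fin n stands for
-- the integer toℕ i + 1.  Positions in a sequence of length n are Fin n
-- (0-based).

iter : ∀ {m} → Permutation′ (suc m) → ℕ → Fin (suc m)
iter π zero    = fzero
iter π (suc k) = π ⟨$⟩ʳ iter π k

-- Standard cycle form (c_1, ..., c_n): c_1 = 1, c_{i+1} = π(c_i).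
-- Position p (0-based) holds c_{p+1}, returned as an integer in [n].
cycleForm : ∀ {m} → Permutation′ (suc m) → Fin (suc m) → ℕ
cycleForm π p = suc (toℕ (iter π (toℕ p)))

oneLine : ∀ {m} → Permutation′ (suc m) → Fin (suc m) → ℕ
oneLine π p = suc (toℕ (π ⟨$⟩ʳ p))

-- π is cyclic: it consists of a single n-cycle, i.e. the orbit
-- 1, π(1), ..., π^{n-1}(1) consists of n distinct elements.
IsCyclic : ∀ {m} → Permutation′ (suc m) → Set
IsCyclic {m} π = ∀ (i j : Fin (suc m)) → iter π (toℕ i) ≡ iter π (toℕ j) → i ≡ j

Contains : ∀ {n k} → (Fin n → ℕ) → Vec ℕ k → Set
Contains {n} {k} w σ =
  Σ (Fin k → Fin n) λ f →
    (∀ (s t : Fin k) → s <ᶠ t → f s <ᶠ f t) ×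
    (∀ (s t : Fin k) → s <ᶠ t → ((w (f t) < w (f s)) ⇔ (lookup σ t < lookup σ s)))

Avoids : ∀ {n k} → (Fin n → ℕ) → Vec ℕ k → Set
Avoids w σ = ¬ Contains w σ

InA : ∀ {m k l} → Vec ℕ k → Vec ℕ l → Permutation′ (suc m) → Set
InA σ ρ π = IsCyclic π × Avoids (oneLine π) σ × Avoids (cycleForm π) ρ

{-# OPTIONS --safe #-}
-- Read the cycle form as the orbit 1, π(1), π²(1), … and let 2 sit at position r ≥ 3.
-- Avoiding 213 in the cycle form means that after a descent c_a > c_b (a < b) every later
-- entry is below c_a.  We show c_{r+s} = s + 2 by induction on s.  If v = c_{r+s} ≠ s + 2,
-- then v > s + 2 and s + 2 sits at a position q outside 1, r, …, r+s−1 (which carry the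
-- values below s + 2).  If q < r, the descent c_q > c_r = 2 forces v < s + 2.  If q > r + s,
-- put p = c_{q−1} and d = c_{r−1}: the descents d > 2 and c₂ > 2 give p < d and v < c₂, so
-- 1 < s + 1 < p < d are sent by π to c₂ > v > s + 2 > 2, a 4321 in the one-line notation.
module Submission where

open import Defs
open import Data.Nat using (ℕ; zero; suc; _≤_; _<_; _≰_; z<s; s≤s; _≟_; _<?_; _+_; _∸_)
open import Data.Nat.Properties
open import Data.Nat.Induction using (<-rec)
open import Data.Fin using (Fin; toℕ; fromℕ<; punchOut)
  renaming (zero to fzero; suc to fsuc; _<_ to _<ᶠ_)
open import Data.Fin.Properties using (toℕ-fromℕ<; toℕ-injective; toℕ<n; punchOut-injective; any?; injective⇒≤)
  renaming (_≟_ to _≟ᶠ_)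
open import Data.Fin.Permutation using (Permutation′)
open import Data.Vec using (_∷_; [])
open import Data.Product using (_,_; ∃; _×_)
open import Data.Empty using (⊥; ⊥-elim)
open import Function.Bundles using (mk⇔)
open import Function.Definitions using (Injective)
open import Relation.Nullary using (yes; no; contradiction)
open import Relation.Nullary.Decidable using (from-yes)
open import Relation.Binary using (tri<; tri≈; tri>)
open import Relation.Binary.PropositionalEquality using (_≡_; _≢_; refl; sym; trans; cong; subst; subst₂; module ≡-Reasoning)

ordered-pairs₃ : {P : Fin 3 → Fin 3 → Set} →
  P fzero (fsuc fzero) → P fzero (fsuc (fsuc fzero)) → P (fsuc fzero) (fsuc (fsuc fzero)) →
  ∀ s t → s <ᶠ t → P s t
ordered-pairs₃ p₀₁ _ _ fzero (fsuc fzero) _ = p₀₁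
ordered-pairs₃ _ p₀₂ _ fzero (fsuc (fsuc fzero)) _ = p₀₂
ordered-pairs₃ _ _ p₁₂ (fsuc fzero) (fsuc (fsuc fzero)) _ = p₁₂
ordered-pairs₃ _ _ _ fzero fzero ()
ordered-pairs₃ _ _ _ (fsuc _) fzero ()
ordered-pairs₃ _ _ _ (fsuc fzero) (fsuc fzero) (s≤s ())
ordered-pairs₃ _ _ _ (fsuc (fsuc fzero)) (fsuc fzero) (s≤s ())
ordered-pairs₃ _ _ _ (fsuc (fsuc fzero)) (fsuc (fsuc fzero)) (s≤s (s≤s ()))

ordered-pairs₄ : {P : Fin 4 → Fin 4 → Set} →
  P fzero (fsuc fzero) → P fzero (fsuc (fsuc fzero)) → P fzero (fsuc (fsuc (fsuc fzero))) →
  P (fsuc fzero) (fsuc (fsuc fzero)) → P (fsuc fzero) (fsuc (fsuc (fsuc fzero))) →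
  P (fsuc (fsuc fzero)) (fsuc (fsuc (fsuc fzero))) →
  ∀ s t → s <ᶠ t → P s t
ordered-pairs₄ p₀₁ _ _ _ _ _ fzero (fsuc fzero) _ = p₀₁
ordered-pairs₄ _ p₀₂ _ _ _ _ fzero (fsuc (fsuc fzero)) _ = p₀₂
ordered-pairs₄ _ _ p₀₃ _ _ _ fzero (fsuc (fsuc (fsuc fzero))) _ = p₀₃
ordered-pairs₄ _ _ _ p₁₂ _ _ (fsuc fzero) (fsuc (fsuc fzero)) _ = p₁₂
ordered-pairs₄ _ _ _ _ p₁₃ _ (fsuc fzero) (fsuc (fsuc (fsuc fzero))) _ = p₁₃
ordered-pairs₄ _ _ _ _ _ p₂₃ (fsuc (fsuc fzero)) (fsuc (fsuc (fsuc fzero))) _ = p₂₃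
ordered-pairs₄ _ _ _ _ _ _ fzero fzero ()
ordered-pairs₄ _ _ _ _ _ _ (fsuc _) fzero ()
ordered-pairs₄ _ _ _ _ _ _ (fsuc fzero) (fsuc fzero) (s≤s ())
ordered-pairs₄ _ _ _ _ _ _ (fsuc (fsuc _)) (fsuc fzero) (s≤s ())
ordered-pairs₄ _ _ _ _ _ _ (fsuc (fsuc fzero)) (fsuc (fsuc fzero)) (s≤s (s≤s ()))
ordered-pairs₄ _ _ _ _ _ _ (fsuc (fsuc (fsuc fzero))) (fsuc (fsuc fzero)) (s≤s (s≤s ()))
ordered-pairs₄ _ _ _ _ _ _ (fsuc (fsuc (fsuc fzero))) (fsuc (fsuc (fsuc fzero))) (s≤s (s≤s (s≤s ())))

contains-213 : ∀ {n} (w : Fin n → ℕ) {a b c : Fin n} → a <ᶠ b → b <ᶠ c →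
  w b < w a → w a < w c → Contains w (2 ∷ 1 ∷ 3 ∷ [])
contains-213 w {a} {b} {c} a<b b<c wb<wa wa<wc = at , ordered-pairs₃ a<b (<-trans a<b b<c) b<c , ordered-pairs₃
    (mk⇔ (λ _ → from-yes (1 <? 2)) (λ _ → wb<wa))
    (mk⇔ (λ wc<wa → contradiction wa<wc (<-asym wc<wa)) (λ { (s≤s (s≤s ())) }))
    (mk⇔ (λ wc<wb → contradiction (<-trans wb<wa wa<wc) (<-asym wc<wb)) (λ { (s≤s ()) }))
  where
  at : Fin 3 → Fin _
  at fzero = a
  at (fsuc fzero) = b
  at (fsuc (fsuc fzero)) = c

contains-4321 : ∀ {n} (w : Fin n → ℕ) {a b c d : Fin n} → a <ᶠ b → b <ᶠ c → c <ᶠ d →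
  w b < w a → w c < w b → w d < w c → Contains w (4 ∷ 3 ∷ 2 ∷ 1 ∷ [])
contains-4321 w {a} {b} {c} {d} a<b b<c c<d wb<wa wc<wb wd<wc =
  at , ordered-pairs₄ a<b (<-trans a<b b<c) (<-trans a<b b<c<d) b<c b<c<d c<d , ordered-pairs₄
    (mk⇔ (λ _ → from-yes (3 <? 4)) (λ _ → wb<wa))
    (mk⇔ (λ _ → from-yes (2 <? 4)) (λ _ → <-trans wc<wb wb<wa))
    (mk⇔ (λ _ → from-yes (1 <? 4)) (λ _ → <-trans wd<wc (<-trans wc<wb wb<wa)))
    (mk⇔ (λ _ → from-yes (2 <? 3)) (λ _ → wc<wb))
    (mk⇔ (λ _ → from-yes (1 <? 3)) (λ _ → <-trans wd<wc wc<wb))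
    (mk⇔ (λ _ → from-yes (1 <? 2)) (λ _ → wd<wc))
  where
  b<c<d : b <ᶠ d
  b<c<d = <-trans b<c c<d
  at : Fin 4 → Fin _
  at fzero = a
  at (fsuc fzero) = b
  at (fsuc (fsuc fzero)) = c
  at (fsuc (fsuc (fsuc fzero))) = d

injective⇒surjective : ∀ {n} {f : Fin n → Fin n} → Injective _≡_ _≡_ f → ∀ y → ∃ λ i → f i ≡ y
injective⇒surjective {zero} _ ()
injective⇒surjective {suc n} {f} f-injective y with any? (λ i → f i ≟ᶠ y)
... | yes hit = hit
... | no miss = contradiction (injective⇒≤ punchOut∘f-injective) 1+n≰n
  where
  y≢f : ∀ i → y ≢ f i
  y≢f i y≡fi = miss (i , sym y≡fi)
  punchOut∘f-injective : Injective _≡_ _≡_ (λ i → punchOut (y≢f i))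
  punchOut∘f-injective e = f-injective (punchOut-injective (y≢f _) (y≢f _) e)

module Orbit {m} (π : Permutation′ (suc m)) (cyclic : IsCyclic π) where

  N : ℕ
  N = suc m

  -- orbit k = c_{k+1} − 1: positions and values both start at 0.
  orbit : ℕ → ℕ
  orbit k = toℕ (iter π k)

  orbit<N : ∀ k → orbit k < N
  orbit<N k = toℕ<n (iter π k)

  cycleForm-fromℕ< : ∀ {a} (a<N : a < N) → cycleForm π (fromℕ< a<N) ≡ suc (orbit a)
  cycleForm-fromℕ< a<N = cong (λ k → suc (orbit k)) (toℕ-fromℕ< a<N)

  orbit-injective : ∀ {a b} → a < N → b < N → orbit a ≡ orbit b → a ≡ b
  orbit-injective {a} {b} a<N b<N e = begin
    a                 ≡⟨ toℕ-fromℕ< a<N ⟨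
    toℕ (fromℕ< a<N) ≡⟨ cong toℕ (cyclic _ _ same-iterate) ⟩
    toℕ (fromℕ< b<N) ≡⟨ toℕ-fromℕ< b<N ⟩
    b                 ∎
    where
    open ≡-Reasoning
    same-iterate : iter π (toℕ (fromℕ< a<N)) ≡ iter π (toℕ (fromℕ< b<N))
    same-iterate rewrite toℕ-fromℕ< a<N | toℕ-fromℕ< b<N = toℕ-injective e

  orbit-surjective : ∀ {y} → y < N → ∃ λ q → q < N × orbit q ≡ y
  orbit-surjective y<N with injective⇒surjective (λ {i} {j} → cyclic i j) (fromℕ< y<N)
  ... | i , e = toℕ i , toℕ<n i , trans (cong toℕ e) (toℕ-fromℕ< y<N)

  1<orbit : ∀ {a} → 0 < a → a < N → orbit a ≢ 1 → 1 < orbit a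
  1<orbit {a} 0<a a<N orbit≢1 = ≤∧≢⇒< (n≢0⇒n>0 orbit≢0) (λ e → orbit≢1 (sym e))
    where
    orbit≢0 : orbit a ≢ 0
    orbit≢0 e = >⇒≢ 0<a (orbit-injective a<N (<-≤-trans 0<a (<⇒≤ a<N)) e)

  module Avoiding (avoids-4321 : Avoids (oneLine π) (4 ∷ 3 ∷ 2 ∷ 1 ∷ []))
                  (avoids-213 : Avoids (cycleForm π) (2 ∷ 1 ∷ 3 ∷ [])) where

    no-213 : ∀ {a b c} → a < b → b < c → c < N → orbit b < orbit a → orbit a < orbit c → ⊥
    no-213 {a} {b} {c} a<b b<c c<N ob<oa oa<oc = avoids-213 (contains-213 (cycleForm π)
        (fromℕ<-mono a<N b<N a<b) (fromℕ<-mono b<N c<N b<c)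
        (subst₂ _<_ (sym (cycleForm-fromℕ< b<N)) (sym (cycleForm-fromℕ< a<N)) (s≤s ob<oa))
        (subst₂ _<_ (sym (cycleForm-fromℕ< a<N)) (sym (cycleForm-fromℕ< c<N)) (s≤s oa<oc)))
      where
      b<N : b < N
      b<N = <-trans b<c c<N
      a<N : a < N
      a<N = <-trans a<b b<N
      fromℕ<-mono : ∀ {i j} (i<N : i < N) (j<N : j < N) → i < j → fromℕ< i<N <ᶠ fromℕ< j<N
      fromℕ<-mono i<N j<N = subst₂ _<_ (sym (toℕ-fromℕ< i<N)) (sym (toℕ-fromℕ< j<N))

    -- In one-line notation the element at orbit position k is sent to the one at position suc k.
    no-4321 : ∀ {a b c d} → orbit a < orbit b → orbit b < orbit c → orbit c < orbit d →
      orbit (suc b) < orbit (suc a) → orbit (suc c) < orbit (suc b) → orbit (suc d) < orbit (suc c) → ⊥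
    no-4321 a<b b<c c<d πb<πa πc<πb πd<πc =
      avoids-4321 (contains-4321 (oneLine π) a<b b<c c<d (s≤s πb<πa) (s≤s πc<πb) (s≤s πd<πc))

    below-after-descent : ∀ {a b c} → a < b → b < c → c < N → orbit b < orbit a → orbit c < orbit a
    below-after-descent {a} {b} {c} a<b b<c c<N ob<oa with <-cmp (orbit c) (orbit a)
    ... | tri< oc<oa _ _ = oc<oa
    ... | tri≈ _ oc≡oa _ = contradiction (orbit-injective c<N (<-trans a<b (<-trans b<c c<N)) oc≡oa)
                                         (>⇒≢ (<-trans a<b b<c))
    ... | tri> _ _ oa<oc = ⊥-elim (no-213 a<b b<c c<N ob<oa oa<oc)

    module After-2 (R₁ : ℕ) (0<R₁ : 0 < R₁) (R<N : suc R₁ < N)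
                   (orbit-R : orbit (suc R₁) ≡ 1) (1<orbit-1 : 1 < orbit 1) where

      R : ℕ
      R = suc R₁

      R₁<N : R₁ < N
      R₁<N = <-trans (n<1+n R₁) R<N

      orbit-R<orbit-1 : orbit R < orbit 1
      orbit-R<orbit-1 = subst (_< orbit 1) (sym orbit-R) 1<orbit-1

      orbit-R<orbit-R₁ : orbit R < orbit R₁
      orbit-R<orbit-R₁ = subst (_< orbit R₁) (sym orbit-R) (1<orbit 0<R₁ R₁<N orbit-R₁≢1)
        where
        orbit-R₁≢1 : orbit R₁ ≢ 1
        orbit-R₁≢1 e = <⇒≢ (n<1+n R₁) (orbit-injective R₁<N R<N (trans e (sym orbit-R)))

      module Step (t : ℕ) (earlier : ∀ s → s ≤ t → orbit (s + R) ≡ suc s) (x<N : suc t + R < N) where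

        x : ℕ
        x = suc t + R

        orbit-≤-on-block : ∀ {k} → R ≤ k → k < x → orbit k ≤ suc t
        orbit-≤-on-block {k} R≤k k<x = begin
          orbit k               ≡⟨ cong orbit (m∸n+n≡m R≤k) ⟨
          orbit (k ∸ R + R)     ≡⟨ earlier (k ∸ R) k∸R≤t ⟩
          suc (k ∸ R)           ≤⟨ s≤s k∸R≤t ⟩
          suc t                 ∎
          where
          open ≤-Reasoning
          k∸R≤t : k ∸ R ≤ t
          k∸R≤t = subst (k ∸ R ≤_) (m+n∸n≡m t R) (∸-monoˡ-≤ R (≤-pred k<x))

        orbit->-from-x : ∀ {k} → x ≤ k → k < N → suc t < orbit k
        orbit->-from-x {k} x≤k k<N = ≰⇒> not-small
          where
          not-small : orbit k ≰ suc t
          not-small ok≤ with orbit k in ok | ok≤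
          ... | zero  | _       = m<n⇒n≢0 x≤k (orbit-injective k<N (<-≤-trans z<s R<N) ok)
          ... | suc s | s≤s s≤t = <⇒≢ s+R<k (sym k≡s+R)
            where
            s+R<k : s + R < k
            s+R<k = <-≤-trans (s≤s (+-monoˡ-≤ R s≤t)) x≤k
            k≡s+R : k ≡ s + R
            k≡s+R = orbit-injective k<N (<-trans s+R<k k<N) (trans ok (sym (earlier s s≤t)))

        R<x : R < x
        R<x = m<n+m R z<s

        orbit-R<next : orbit R < suc (suc t)
        orbit-R<next = subst (_< suc (suc t)) (sym orbit-R) (s≤s z<s)

        no-earlier-position : ∀ {q} → q < x → orbit q ≡ suc (suc t) → suc (suc t) < orbit x → ⊥
        no-earlier-position {q} q<x oq skipped with q <? R
        ... | yes q<R = <-asym skipped (subst (orbit x <_) oq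
                          (below-after-descent q<R R<x x<N (subst (orbit R <_) (sym oq) orbit-R<next)))
        ... | no  q≮R = 1+n≰n (subst (_≤ suc t) oq (orbit-≤-on-block (≮⇒≥ q≮R) q<x))

        no-later-position : ∀ {q} → x < q → q < N → orbit q ≡ suc (suc t) → suc (suc t) < orbit x → ⊥
        no-later-position {suc q′} (s≤s x≤q′) q<N oq skipped = no-4321 {0} {t + R} {q′} {R₁}
          (subst (0 <_) (sym orbit-t+R) z<s)
          (subst (_< orbit q′) (sym orbit-t+R) (orbit->-from-x x≤q′ q′<N))
          (below-after-descent (n<1+n R₁) (<-≤-trans R<x x≤q′) q′<N orbit-R<orbit-R₁)
          (below-after-descent (s≤s 0<R₁) R<x x<N orbit-R<orbit-1)
          (subst (_< orbit x) (sym oq) skipped)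
          (subst (orbit R <_) (sym oq) orbit-R<next)
          where
          q′<N : q′ < N
          q′<N = <-trans (n<1+n q′) q<N
          orbit-t+R : orbit (t + R) ≡ suc t
          orbit-t+R = earlier t ≤-refl

        orbit-next : orbit x ≡ suc (suc t)
        orbit-next with orbit x ≟ suc (suc t)
        ... | yes ox≡ = ox≡
        ... | no  ox≢ = ⊥-elim (position-of-next (orbit-surjective (<-trans skipped (orbit<N x))))
          where
          skipped : suc (suc t) < orbit x
          skipped = ≤∧≢⇒< (orbit->-from-x ≤-refl x<N) (λ e → ox≢ (sym e))
          position-of-next : (∃ λ q → q < N × orbit q ≡ suc (suc t)) → ⊥
          position-of-next (q , q<N , oq) with <-cmp q x
          ... | tri< q<x _ _ = no-earlier-position q<x oq skipped
          ... | tri≈ _ refl _ = ox≢ oq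
          ... | tri> _ _ x<q = no-later-position x<q q<N oq skipped

      orbit-after-2 : ∀ s → s + R < N → orbit (s + R) ≡ suc s
      orbit-after-2 = <-rec _ step
        where
        step : ∀ s → (∀ {s′} → s′ < s → s′ + R < N → orbit (s′ + R) ≡ suc s′) →
               s + R < N → orbit (s + R) ≡ suc s
        step zero    _  _   = orbit-R
        step (suc t) ih x<N = Step.orbit-next t earlier x<N
          where
          earlier : ∀ s → s ≤ t → orbit (s + R) ≡ suc s
          earlier s s≤t = ih (s≤s s≤t) (≤-<-trans (+-monoˡ-≤ R s≤t) (<-trans (n<1+n (t + R)) x<N))

      orbit-increasing-after-2 : ∀ {i j} → R ≤ i → i < j → j < N → orbit i < orbit j
      orbit-increasing-after-2 {i} {j} R≤i i<j j<N =
        subst₂ _<_ (sym (orbit-from-2 R≤i (<-trans i<j j<N))) (sym (orbit-from-2 (≤-trans R≤i (<⇒≤ i<j)) j<N))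
          (s≤s (∸-monoˡ-< i<j R≤i))
        where
        orbit-from-2 : ∀ {k} → R ≤ k → k < N → orbit k ≡ suc (k ∸ R)
        orbit-from-2 {k} R≤k k<N = trans (cong orbit (sym (m∸n+n≡m R≤k)))
          (orbit-after-2 (k ∸ R) (subst (_< N) (sym (m∸n+n≡m R≤k)) k<N))

lemma3p1 : (m : ℕ) → 5 ≤ suc m → (π : Permutation′ (suc m)) →
    InA (4 ∷ 3 ∷ 2 ∷ 1 ∷ []) (2 ∷ 1 ∷ 3 ∷ []) π →
    ((p : Fin (suc m)) → toℕ p ≡ 1 → cycleForm π p ≢ 2) →
    (r : Fin (suc m)) → cycleForm π r ≡ 2 →
    (i j : Fin (suc m)) → r <ᶠ i → i <ᶠ j → cycleForm π i < cycleForm π j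
lemma3p1 m _ π (cyclic , avoids-4321 , avoids-213) c₂≢2 r c-r≡2 i j r<i i<j with toℕ r in r≡R
... | zero     = contradiction c-r≡2 λ ()
... | suc zero = contradiction c-r≡2 λ c-1≡2 → c₂≢2 r r≡R (trans (cong (λ k → suc (toℕ (iter π k))) r≡R) c-1≡2)
... | suc (suc R₁) = s≤s (orbit-increasing-after-2 (<⇒≤ r<i) i<j (toℕ<n j))
  where
  open Orbit π cyclic
  open Avoiding avoids-4321 avoids-213
  R<N : suc (suc R₁) < N
  R<N = subst (_< N) r≡R (toℕ<n r)
  1<N : 1 < N
  1<N = <-trans (s≤s z<s) R<N
  orbit-1≢1 : orbit 1 ≢ 1
  orbit-1≢1 e = c₂≢2 (fromℕ< 1<N) (toℕ-fromℕ< 1<N) (trans (cycleForm-fromℕ< 1<N) (cong suc e))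
  open After-2 (suc R₁) z<s R<N (suc-injective c-r≡2) (1<orbit z<s 1<N orbit-1≢1)
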